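{- Let $M$ be a square matrix that is irreducible, substochastic and idempotent. Then $M$ is a 1-SI matrix. Moreover, $M=\boldsymbol{1}\boldsymbol{\pi}$, where $\boldsymbol{\pi}$ is a positive row vector with $\boldsymbol{\pi}\boldsymbol{1}=1$.
   Context: $\boldsymbol{1}$ denotes the all-ones column (or row) vector of appropriate size. A matrix $M$ is substochastic if it is nonnegative and $M\boldsymbol{1}\le\boldsymbol{1}$ entrywise. An SI matrix is a matrix that is stochastic (nonnegative with all row sums equal to 1) and idempotent ($M^2=M$); an $r$-SI matrix is an SI matrix of rank $r$. -}

module Defs where

open import Level using (Level; _⊔_) renaming (suc to lsuc)
open import Data.Nat using (ℕ; zero; suc) renaming (_<_ to _<ℕ_)
open import Data.Fin using (Fin)
open import Data.Product using (Σ; ∃; _×_; _,_)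
open import Relation.Nullary using (¬_)
open import Relation.Binary using (Rel; IsDecTotalOrder)
open import Algebra.Structures using (IsCommutativeRing)

-- The real numbers are an instance.
record OrderedField (c ℓ₁ ℓ₂ : Level) : Set (lsuc (c ⊔ ℓ₁ ⊔ ℓ₂)) where
  infix  4 _≈_ _≤_ _<_
  infixl 6 _+_
  infixl 7 _*_
  field
    Carrier : Set c
    _≈_     : Rel Carrier ℓ₁
    _≤_     : Rel Carrier ℓ₂
    _+_ _*_ : Carrier → Carrier → Carrier
    -_      : Carrier → Carrier
    0# 1#   : Carrier
    _⁻¹     : Carrier → Carrier
    isCommutativeRing : IsCommutativeRing _≈_ _+_ _*_ -_ 0# 1#
    isDecTotalOrder   : IsDecTotalOrder _≈_ _≤_
    0≉1     : ¬ (0# ≈ 1#)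
    ⁻¹-inverse : ∀ x → ¬ (x ≈ 0#) → (x * (x ⁻¹)) ≈ 1#
    +-mono-≤   : ∀ {x y} z → x ≤ y → (x + z) ≤ (y + z)
    *-nonneg   : ∀ {x y} → 0# ≤ x → 0# ≤ y → 0# ≤ (x * y)

  _<_ : Carrier → Carrier → Set (ℓ₁ ⊔ ℓ₂)
  x < y = (x ≤ y) × ¬ (x ≈ y)

module MatrixDefs {c ℓ₁ ℓ₂ : Level} (F : OrderedField c ℓ₁ ℓ₂) where
  open OrderedField F

  Matrix : ℕ → ℕ → Set c
  Matrix m n = Fin m → Fin n → Carrier

  ∑ : ∀ {n} → (Fin n → Carrier) → Carrier
  ∑ {zero}  f = 0#
  ∑ {suc n} f = f Fin.zero + ∑ (λ i → f (Fin.suc i))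

  _⊗_ : ∀ {m k n} → Matrix m k → Matrix k n → Matrix m n
  (A ⊗ B) i j = ∑ (λ l → A i l * B l j)

  _≋_ : ∀ {m n} → Matrix m n → Matrix m n → Set ℓ₁
  A ≋ B = ∀ i j → A i j ≈ B i j

  -- M ^ (suc k), powers with exponent ≥ 1
  pow : ∀ {n} → Matrix n n → ℕ → Matrix n n
  pow M zero    = M
  pow M (suc k) = pow M k ⊗ M

  𝟏col : ∀ {n} → Matrix n 1
  𝟏col _ _ = 1#

  𝟏row : ∀ {n} → Matrix 1 n
  𝟏row _ _ = 1#

  Nonnegative : ∀ {m n} → Matrix m n → Set ℓ₂
  Nonnegative A = ∀ i j → 0# ≤ A i j

  Substochastic : ∀ {n} → Matrix n n → Set ℓ₂
  Substochastic M = Nonnegative M × (∀ i → (M ⊗ 𝟏col) i Fin.zero ≤ 1#)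

  Stochastic : ∀ {n} → Matrix n n → Set (ℓ₁ ⊔ ℓ₂)
  Stochastic M = Nonnegative M × (M ⊗ 𝟏col) ≋ 𝟏col

  Idempotent : ∀ {n} → Matrix n n → Set ℓ₁
  Idempotent M = (M ⊗ M) ≋ M

  -- irreducible: for all i, j some power M^k (k ≥ 1) has a positive (i,j) entry
  -- (equivalently, the digraph of M is strongly connected via paths of length ≥ 1)
  Irreducible : ∀ {n} → Matrix n n → Set (ℓ₁ ⊔ ℓ₂)
  Irreducible M = ∀ i j → ∃ λ k → 0# < pow M k i j

  -- rank via factorisations: M has a factorisation A ⊗ B through r
  Factorises : ∀ {m n} → Matrix m n → ℕ → Set (c ⊔ ℓ₁)
  Factorises {m} {n} M r = Σ (Matrix m r) λ A → Σ (Matrix r n) λ B → (A ⊗ B) ≋ M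

  HasRank : ∀ {m n} → Matrix m n → ℕ → Set (c ⊔ ℓ₁)
  HasRank M r = Factorises M r × (∀ s → s <ℕ r → ¬ Factorises M s)

  SI : ∀ {n} → ℕ → Matrix n n → Set (c ⊔ ℓ₁ ⊔ ℓ₂)
  SI r M = Stochastic M × Idempotent M × HasRank M r

{-# OPTIONS --safe #-}
-- Idempotency collapses all powers of M to M itself, so irreducibility makes
-- every entry of M positive.  Both the row-sum vector M𝟏 and every column of M
-- are fixed by M; an identity  ∑ₗ wₗ fₗ = ∑ₗ wₗ gₗ  with positive weights and
-- f ≤ g forces f = g.  Comparing the row sums with 𝟏 (they are ≤ 𝟏) shows that
-- M is stochastic, and comparing a column with its minimum entry shows that the
-- column is constant, so M = 𝟏π with π the (positive) common row.
module Submission where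

open import Defs
open import Data.Nat using (ℕ; zero; suc; s≤s) renaming (_<_ to _<ℕ_)
open import Data.Fin using (Fin)
open import Data.List using (allFin)
open import Data.List.Relation.Unary.All using (lookup)
open import Data.List.Membership.Propositional.Properties using (∈-allFin)
open import Data.Product using (Σ; ∃; _×_; _,_; proj₁; proj₂)
open import Function using (_∘_)
open import Level using (_⊔_)
open import Relation.Nullary using (¬_)
open import Relation.Binary.PropositionalEquality as ≡ using (_≡_)
open import Relation.Binary.Bundles using (TotalOrder)
open import Relation.Binary.Structures using (IsDecTotalOrder)
open import Algebra.Bundles using (CommutativeRing)
import Algebra.Properties.Ring as RingProperties
import Algebra.Properties.Semiring.Sum as SemiringSum
import Data.List.Extrema as Extrema
import Relation.Binary.Reasoning.Setoid as SetoidReasoning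

module _ {c ℓ₁ ℓ₂} (F : OrderedField c ℓ₁ ℓ₂) where

  open OrderedField F
    using (_≤_; _<_; _⁻¹; ⁻¹-inverse; +-mono-≤; *-nonneg; isCommutativeRing; isDecTotalOrder)
  open MatrixDefs F

  commutativeRing : CommutativeRing c ℓ₁
  commutativeRing = record { isCommutativeRing = isCommutativeRing }

  open CommutativeRing commutativeRing
  open RingProperties ring using (-1*x≈-x; x[y-z]≈xy-xz; x∙y⁻¹≈ε⇒x≈y)
  open SemiringSum semiring
    using (sum; sum-cong-≋; sum-cong-≗; ∑-distrib-+; *-distribˡ-sum; *-distribʳ-sum)
    renaming (∑-comm to sum-comm)
  open IsDecTotalOrder isDecTotalOrder
    using (isTotalOrder; ≤-respˡ-≈; ≤-respʳ-≈)
    renaming (refl to ≤-refl; trans to ≤-trans; antisym to ≤-antisym)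
  open SetoidReasoning setoid

  totalOrder : TotalOrder c ℓ₁ ℓ₂
  totalOrder = record { isTotalOrder = isTotalOrder }

  open Extrema totalOrder using (f[argmin]≤f[xs]) renaming (argmin to argminᴸ)

  ∑≡sum : ∀ {n} (f : Fin n → Carrier) → ∑ f ≡ sum f
  ∑≡sum {zero}  f = ≡.refl
  ∑≡sum {suc n} f = ≡.cong (f Fin.zero +_) (∑≡sum (f ∘ Fin.suc))

  ∑-cong : ∀ {n} {f g : Fin n → Carrier} → (∀ i → f i ≈ g i) → ∑ f ≈ ∑ g
  ∑-cong {f = f} {g} f≈g rewrite ∑≡sum f | ∑≡sum g = sum-cong-≋ f≈g

  ∑-comm : ∀ {m n} (f : Fin m → Fin n → Carrier) →
           ∑ (λ i → ∑ (f i)) ≈ ∑ (λ j → ∑ (λ i → f i j))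
  ∑-comm f rewrite ∑≡sum (λ i → ∑ (f i)) | ∑≡sum (λ j → ∑ (λ i → f i j))
                 | sum-cong-≗ (λ i → ∑≡sum (f i)) | sum-cong-≗ (λ j → ∑≡sum (λ i → f i j))
                 = sum-comm f

  *-distribˡ-∑ : ∀ {n} x (f : Fin n → Carrier) → x * ∑ f ≈ ∑ (λ i → x * f i)
  *-distribˡ-∑ x f rewrite ∑≡sum f | ∑≡sum (λ i → x * f i) = *-distribˡ-sum x f

  *-distribʳ-∑ : ∀ {n} x (f : Fin n → Carrier) → ∑ f * x ≈ ∑ (λ i → f i * x)
  *-distribʳ-∑ x f rewrite ∑≡sum f | ∑≡sum (λ i → f i * x) = *-distribʳ-sum x f

  ∑-distrib-- : ∀ {n} (f g : Fin n → Carrier) → ∑ (λ i → f i - g i) ≈ ∑ f - ∑ g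
  ∑-distrib-- f g = begin
    ∑ (λ i → f i - g i)            ≡⟨ ∑≡sum (λ i → f i - g i) ⟩
    sum (λ i → f i - g i)          ≈⟨ ∑-distrib-+ f (λ i → - g i) ⟩
    sum f + sum (λ i → - g i)      ≈⟨ +-congˡ (sum-cong-≋ (λ i → -1*x≈-x (g i))) ⟨
    sum f + sum (λ i → - 1# * g i) ≈⟨ +-congˡ (*-distribˡ-sum (- 1#) g) ⟨
    sum f + - 1# * sum g           ≈⟨ +-congˡ (-1*x≈-x (sum g)) ⟩
    sum f - sum g                  ≡⟨ ≡.cong₂ _-_ (∑≡sum f) (∑≡sum g) ⟨
    ∑ f - ∑ g                      ∎

  x≤x+y : ∀ {x y} → 0# ≤ y → x ≤ x + y
  x≤x+y {x} {y} 0≤y = ≤-respˡ-≈ (+-identityˡ x) (≤-respʳ-≈ (+-comm y x) (+-mono-≤ x 0≤y))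

  x≤y⇒0≤y-x : ∀ {x y} → x ≤ y → 0# ≤ y - x
  x≤y⇒0≤y-x {x} x≤y = ≤-respˡ-≈ (-‿inverseʳ x) (+-mono-≤ (- x) x≤y)

  <-respʳ-≈ : ∀ {x y z} → x < y → y ≈ z → x < z
  <-respʳ-≈ (x≤y , x≉y) y≈z = ≤-respʳ-≈ y≈z x≤y , λ x≈z → x≉y (trans x≈z (sym y≈z))

  0<x⇒x*y≈0⇒y≈0 : ∀ {x y} → 0# < x → x * y ≈ 0# → y ≈ 0#
  0<x⇒x*y≈0⇒y≈0 {x} {y} (_ , 0≉x) xy≈0 = begin
    y              ≈⟨ *-identityˡ y ⟨
    1# * y         ≈⟨ *-congʳ (trans (*-comm (x ⁻¹) x) (⁻¹-inverse x (0≉x ∘ sym))) ⟨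
    (x ⁻¹ * x) * y ≈⟨ *-assoc (x ⁻¹) x y ⟩
    x ⁻¹ * (x * y) ≈⟨ *-congˡ xy≈0 ⟩
    x ⁻¹ * 0#      ≈⟨ zeroʳ (x ⁻¹) ⟩
    0#             ∎

  ∑-nonneg : ∀ {n} {f : Fin n → Carrier} → (∀ i → 0# ≤ f i) → 0# ≤ ∑ f
  ∑-nonneg {zero}  0≤f = ≤-refl
  ∑-nonneg {suc n} 0≤f = ≤-trans (0≤f Fin.zero) (x≤x+y (∑-nonneg (0≤f ∘ Fin.suc)))

  nonneg-∑≈0⇒≈0 : ∀ {n} {f : Fin n → Carrier} → (∀ i → 0# ≤ f i) → ∑ f ≈ 0# → ∀ i → f i ≈ 0#
  nonneg-∑≈0⇒≈0 {suc n} {f} 0≤f ∑f≈0 = λ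
    { Fin.zero    → ≤-antisym (≤-respʳ-≈ ∑f≈0 (x≤x+y 0≤∑tail)) (0≤f Fin.zero)
    ; (Fin.suc i) → nonneg-∑≈0⇒≈0 (0≤f ∘ Fin.suc) ∑tail≈0 i }
    where
    0≤∑tail : 0# ≤ ∑ (f ∘ Fin.suc)
    0≤∑tail = ∑-nonneg (0≤f ∘ Fin.suc)

    ∑tail≈0 : ∑ (f ∘ Fin.suc) ≈ 0#
    ∑tail≈0 = ≤-antisym (≤-respʳ-≈ (trans (+-comm _ _) ∑f≈0) (x≤x+y (0≤f Fin.zero))) 0≤∑tail

  ≤∧weighted-∑≈⇒≈ : ∀ {n} {w f g : Fin n → Carrier} → (∀ i → 0# < w i) → (∀ i → f i ≤ g i) →
                    ∑ (λ i → w i * f i) ≈ ∑ (λ i → w i * g i) → ∀ i → f i ≈ g i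
  ≤∧weighted-∑≈⇒≈ {w = w} {f} {g} 0<w f≤g ∑wf≈∑wg i =
    sym (x∙y⁻¹≈ε⇒x≈y (g i) (f i) (0<x⇒x*y≈0⇒y≈0 (0<w i) (nonneg-∑≈0⇒≈0 0≤w[g-f] ∑w[g-f]≈0 i)))
    where
    0≤w[g-f] : ∀ i → 0# ≤ w i * (g i - f i)
    0≤w[g-f] i = *-nonneg (proj₁ (0<w i)) (x≤y⇒0≤y-x (f≤g i))

    ∑w[g-f]≈0 : ∑ (λ i → w i * (g i - f i)) ≈ 0#
    ∑w[g-f]≈0 = begin
      ∑ (λ i → w i * (g i - f i))                     ≈⟨ ∑-cong (λ i → x[y-z]≈xy-xz (w i) (g i) (f i)) ⟩
      ∑ (λ i → w i * g i - w i * f i)                 ≈⟨ ∑-distrib-- (λ i → w i * g i) (λ i → w i * f i) ⟩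
      ∑ (λ i → w i * g i) - ∑ (λ i → w i * f i)       ≈⟨ +-congˡ (-‿cong ∑wf≈∑wg) ⟩
      ∑ (λ i → w i * g i) - ∑ (λ i → w i * g i)       ≈⟨ -‿inverseʳ _ ⟩
      0#                                              ∎

  argmin : ∀ {n} (f : Fin (suc n) → Carrier) → ∃ λ i → ∀ k → f i ≤ f k
  argmin {n} f =
    argminᴸ f Fin.zero (allFin (suc n)) ,
    λ k → lookup (f[argmin]≤f[xs] Fin.zero (allFin (suc n))) (∈-allFin k)

  ⊗-congˡ : ∀ {m k n} {A A′ : Matrix m k} (B : Matrix k n) → A ≋ A′ → (A ⊗ B) ≋ (A′ ⊗ B)
  ⊗-congˡ B A≋A′ i j = ∑-cong (λ l → *-congʳ (A≋A′ i l))

  ⊗-assoc : ∀ {m k l n} (A : Matrix m k) (B : Matrix k l) (C : Matrix l n) →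
            ((A ⊗ B) ⊗ C) ≋ (A ⊗ (B ⊗ C))
  ⊗-assoc A B C i j = begin
    ∑ (λ q → ∑ (λ p → A i p * B p q) * C q j)     ≈⟨ ∑-cong (λ q → *-distribʳ-∑ (C q j) (λ p → A i p * B p q)) ⟩
    ∑ (λ q → ∑ (λ p → (A i p * B p q) * C q j))   ≈⟨ ∑-comm (λ q p → (A i p * B p q) * C q j) ⟩
    ∑ (λ p → ∑ (λ q → (A i p * B p q) * C q j))   ≈⟨ ∑-cong (λ p → ∑-cong (λ q → *-assoc (A i p) (B p q) (C q j))) ⟩
    ∑ (λ p → ∑ (λ q → A i p * (B p q * C q j)))   ≈⟨ ∑-cong (λ p → *-distribˡ-∑ (A i p) (λ q → B p q * C q j)) ⟨
    ∑ (λ p → A i p * ∑ (λ q → B p q * C q j))     ∎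

  𝟏col⊗-lookup : ∀ {m n} (π : Matrix 1 n) i j → (𝟏col {m} ⊗ π) i j ≈ π Fin.zero j
  𝟏col⊗-lookup π i j = trans (+-identityʳ (1# * π Fin.zero j)) (*-identityˡ (π Fin.zero j))

  Factorises-0⇒≈0 : ∀ {m n} {M : Matrix m n} → Factorises M 0 → ∀ i j → M i j ≈ 0#
  Factorises-0⇒≈0 (_ , _ , AB≋M) i j = sym (AB≋M i j)

  Positive : ∀ {m n} → Matrix m n → Set (ℓ₁ ⊔ ℓ₂)
  Positive M = ∀ i j → 0# < M i j

  pow-idempotent : ∀ {n} {M : Matrix n n} → Idempotent M → ∀ k → pow M k ≋ M
  pow-idempotent idem zero    = λ _ _ → refl
  pow-idempotent {M = M} idem (suc k) i j = trans (⊗-congˡ M (pow-idempotent idem k) i j) (idem i j)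

  irreducible∧idempotent⇒positive : ∀ {n} {M : Matrix n n} → Irreducible M → Idempotent M → Positive M
  irreducible∧idempotent⇒positive irr idem i j =
    let k , 0<Mᵏij = irr i j in <-respʳ-≈ 0<Mᵏij (pow-idempotent idem k i j)

  positive∧substochastic∧idempotent⇒stochastic : ∀ {n} {M : Matrix n n} →
    Positive M → Substochastic M → Idempotent M → Stochastic M
  positive∧substochastic∧idempotent⇒stochastic {M = M} pos (0≤M , M𝟏≤𝟏) idem =
    0≤M , λ { i Fin.zero → ≤∧weighted-∑≈⇒≈ (pos i) M𝟏≤𝟏 (M[M𝟏]≈M𝟏 i) i }
    where
    M[M𝟏]≈M𝟏 : ∀ i → (M ⊗ (M ⊗ 𝟏col)) i Fin.zero ≈ (M ⊗ 𝟏col) i Fin.zero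
    M[M𝟏]≈M𝟏 i = trans (sym (⊗-assoc M M 𝟏col i Fin.zero)) (⊗-congˡ 𝟏col idem i Fin.zero)

  positive∧stochastic⇒fixed-vector-constant : ∀ {n} {P : Matrix (suc n) (suc n)} → Positive P → Stochastic P →
    (v : Fin (suc n) → Carrier) → (∀ i → ∑ (λ k → P i k * v k) ≈ v i) → ∀ i → v i ≈ v Fin.zero
  positive∧stochastic⇒fixed-vector-constant {n} {P} pos (_ , P𝟏≈𝟏) v Pv≈v i =
    trans (sym (v≈min i)) (v≈min Fin.zero)
    where
    i₀ : Fin (suc n)
    i₀ = proj₁ (argmin v)
    m : Carrier
    m = v i₀

    ∑Pm≈∑Pv : ∑ (λ k → P i₀ k * m) ≈ ∑ (λ k → P i₀ k * v k)
    ∑Pm≈∑Pv = begin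
      ∑ (λ k → P i₀ k * m)          ≈⟨ ∑-cong (λ k → *-congʳ {m} (*-identityʳ (P i₀ k))) ⟨
      ∑ (λ k → (P i₀ k * 1#) * m)   ≈⟨ *-distribʳ-∑ m (λ k → P i₀ k * 1#) ⟨
      ∑ (λ k → P i₀ k * 1#) * m     ≈⟨ *-congʳ (P𝟏≈𝟏 i₀ Fin.zero) ⟩
      1# * m                        ≈⟨ *-identityˡ m ⟩
      m                             ≈⟨ Pv≈v i₀ ⟨
      ∑ (λ k → P i₀ k * v k)        ∎

    v≈min : ∀ k → m ≈ v k
    v≈min = ≤∧weighted-∑≈⇒≈ (pos i₀) (proj₂ (argmin v)) ∑Pm≈∑Pv

  positive∧stochastic∧idempotent⇒≋𝟏col⊗row : ∀ {n} {M : Matrix (suc n) (suc n)} →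
    Positive M → Stochastic M → Idempotent M → M ≋ (𝟏col ⊗ (λ _ → M Fin.zero))
  positive∧stochastic∧idempotent⇒≋𝟏col⊗row {M = M} pos stoch idem i j =
    trans (positive∧stochastic⇒fixed-vector-constant pos stoch (λ k → M k j) (λ k → idem k j) i)
          (sym (𝟏col⊗-lookup (λ _ → M Fin.zero) i j))

  positive∧≋𝟏col⊗π⇒rank1 : ∀ {m n} {M : Matrix (suc m) (suc n)} (π : Matrix 1 (suc n)) →
    Positive M → M ≋ (𝟏col ⊗ π) → HasRank M 1
  positive∧≋𝟏col⊗π⇒rank1 {M = M} π pos M≋𝟏π = (𝟏col , π , λ i j → sym (M≋𝟏π i j)) , no-rank-0
    where
    no-rank-0 : ∀ s → s <ℕ 1 → ¬ Factorises M s
    no-rank-0 zero _ M=AB = proj₂ (pos Fin.zero Fin.zero) (sym (Factorises-0⇒≈0 M=AB Fin.zero Fin.zero))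
    no-rank-0 (suc s) (s≤s ())

lemma4p2 : ∀ {c ℓ₁ ℓ₂} (F : OrderedField c ℓ₁ ℓ₂) (n : ℕ)
             (M : MatrixDefs.Matrix F (suc n) (suc n)) →
             MatrixDefs.Irreducible F M →
             MatrixDefs.Substochastic F M →
             MatrixDefs.Idempotent F M →
             MatrixDefs.SI F 1 M
             × Σ (MatrixDefs.Matrix F 1 (suc n)) (λ π →
                 (∀ j → OrderedField._<_ F (OrderedField.0# F) (π Fin.zero j))
                 × MatrixDefs._≋_ F (MatrixDefs._⊗_ F π (MatrixDefs.𝟏col F)) (λ _ _ → OrderedField.1# F)
                 × MatrixDefs._≋_ F M (MatrixDefs._⊗_ F (MatrixDefs.𝟏col F) π))
lemma4p2 F n M irr sub idem =
  (stochastic , idem , positive∧≋𝟏col⊗π⇒rank1 F π pos M≋𝟏π) , π , pos Fin.zero , π𝟏≈1 , M≋𝟏π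
  where
  open OrderedField F using (1#)
  open MatrixDefs F

  pos : Positive F M
  pos = irreducible∧idempotent⇒positive F irr idem

  stochastic : Stochastic M
  stochastic = positive∧substochastic∧idempotent⇒stochastic F pos sub idem

  π : Matrix 1 (suc n)
  π _ = M Fin.zero

  π𝟏≈1 : (π ⊗ 𝟏col) ≋ (λ _ _ → 1#)
  π𝟏≈1 Fin.zero Fin.zero = proj₂ stochastic Fin.zero Fin.zero

  M≋𝟏π : M ≋ (𝟏col ⊗ π)
  M≋𝟏π = positive∧stochastic∧idempotent⇒≋𝟏col⊗row F pos stochastic idem
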